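{- Let $k$ be a positive integer and $n\geq 8k$. Then there exists a $4k$-graph of order $n$ which is odd-colorable but has no odd transversal.
   Context: An $r$-graph $G$ consists of a vertex set $V(G)$ and a set $E(G)$ of $r$-element subsets of $V(G)$ (edges); its order is $|V(G)|$. An $r$-graph $G$ (with $r$ even) is odd-colorable if there is a map $\varphi:V(G)\to[r]$ such that for every edge $\{i_1,\ldots,i_r\}$, $\varphi(i_1)+\cdots+\varphi(i_r)\equiv r/2\pmod r$. An odd transversal of $G$ is a set $X\subset V(G)$ that intersects every edge in an odd number of vertices. -}

module Defs where

open import Data.Nat as ℕ using (ℕ; _+_; _*_; _%_; _/_)
open import Data.Integer as ℤ using (ℤ; +_)
open import Data.Integer.Divisibility using (_∣_)
open import Data.Fin using (Fin; toℕ; zero; suc)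
open import Data.Fin.Subset using (Subset; ∣_∣; _∩_; _∈_; _∉_; inside; outside)
open import Data.Vec using (Vec; []; _∷_)
open import Data.List using (List)
open import Data.List.Relation.Unary.All using (All)
open import Data.List.Relation.Unary.Unique.Propositional using (Unique)
open import Data.Product using (Σ; _×_)
open import Relation.Binary.PropositionalEquality using (_≡_)

record Graph (r n : ℕ) : Set where
  field
    edges    : List (Subset n)
    distinct : Unique edges
    uniform  : All (λ e → ∣ e ∣ ≡ r) edges
open Graph public

sumOver : ∀ {n} → Subset n → (Fin n → ℕ) → ℕ
sumOver [] f = 0
sumOver (outside ∷ e) f = sumOver e (λ i → f (suc i))
sumOver (inside ∷ e) f = f zero + sumOver e (λ i → f (suc i))

-- Colouring φ : V → [r] = {1,…,r}, encoded as i ↦ 1 + toℕ (c i) with c : Fin n → Fin r.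
_≡_[mod_] : ℕ → ℕ → ℕ → Set
a ≡ b [mod r ] = (+ r) ∣ ((+ a) ℤ.- (+ b))

OddColorable : ∀ {r n} → Graph r n → Set
OddColorable {r} {n} G =
  Σ (Fin n → Fin r) λ c →
    All (λ e → sumOver e (λ i → ℕ.suc (toℕ (c i))) ≡ r / 2 [mod r ]) (edges G)

Odd : ℕ → Set
Odd m = m % 2 ≡ 1

IsOddTransversal : ∀ {r n} → Graph r n → Subset n → Set
IsOddTransversal G X = All (λ e → Odd ∣ X ∩ e ∣) (edges G)

HasOddTransversal : ∀ {r n} → Graph r n → Set
HasOddTransversal {n = n} G = Σ (Subset n) (IsOddTransversal G)

-- Read subsets of the vertex set as vectors over 𝔽₂, with
-- symmetric difference ⊕ as addition.  For fixed X the map e ↦ ∣ X ∩ e ∣ mod 2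
-- is additive, so Σ_e ∣ X ∩ e ∣ ≡ ∣ X ∩ (⊕_e e) ∣ (mod 2).  If every vertex
-- has even degree, ⊕_e e = ∅ and the left side is even; if moreover the number
-- of edges is odd, the edges cannot all meet X oddly.
--
-- Blow up a triangle: blocks of 2k vertices for its corners a, b, c,
-- the remaining vertices isolated, and for each corner Z the edge consisting of
-- the two blocks other than Z.  This 4k-graph has three edges and every vertex
-- has degree 0 or 2, so the obstruction applies.  Colouring half of each block
-- with colour 2 and the other half (and the isolated vertices) with colour 1
-- gives every edge colour sum 6k ≡ 2k = 4k/2 (mod 4k).  This works as soon as
-- n ≥ 6k, in particular for n ≥ 8k.
module Submission where

open import Defs
open import Data.Nat using (ℕ; _≤_; _*_; NonZero)
open import Data.Product using (Σ; _×_)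
open import Relation.Nullary using (¬_)

open import Data.Nat using (zero; suc; _+_; _∸_; _%_; _/_; z≤n; s≤s)
open import Data.Nat.Properties
  using (+-suc; +-identityʳ; *-zeroʳ; ≤-trans; m≤m+n; m≤m*n; *-monoˡ-≤; m+n∸m≡n; m≤n⇒∃[o]m+o≡n)
open import Data.Nat.DivMod using (%-distribˡ-+; m*n/n≡m)
import Data.Nat.Divisibility as ℕ∣
open import Data.Nat.Tactic.RingSolver using (solve-∀)
import Data.Integer as ℤ
open import Data.Integer.Properties using ([+m]-[+n]≡m⊖n; ⊖-≥)
open import Data.Bool using (Bool; true; false; if_then_else_; _xor_)
open import Data.Fin using (Fin; toℕ; fromℕ<)
open import Data.Fin.Properties using (toℕ-fromℕ<)
open import Data.Fin.Subset using (Subset; ∣_∣; _∩_; ⊥; inside; outside)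
open import Data.Fin.Subset.Properties using (∩-zeroʳ; ∣⊥∣≡0)
open import Data.Vec using (Vec; []; _∷_; map; lookup; replicate; _++_; zipWith; sum)
open import Data.Vec.Properties using (map-++; sum-++; map-const; map-cong; ∷-injective)
open import Data.Vec.Membership.Propositional using (_∈_)
open import Data.Vec.Membership.Propositional.Properties using (∈-++⁺ˡ; ∈-++⁺ʳ)
open import Data.Vec.Relation.Unary.Any using (here; there)
open import Data.List using (List; length; foldr)
open import Data.Nat.ListAction using () renaming (sum to sumList)
import Data.List as List
open import Data.List.Relation.Unary.All using (All)
import Data.List.Relation.Unary.All as All
import Data.List.Relation.Unary.AllPairs as AllPairs
open import Data.Product using (_,_; proj₁; proj₂)
open import Function using (_∘_)
open import Relation.Nullary using (contradiction)
open import Relation.Binary.PropositionalEquality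
  using (_≡_; _≢_; refl; sym; trans; cong; cong₂; subst; subst₂; module ≡-Reasoning)

open ≡-Reasoning

+-cong-mod2 : ∀ a a′ b b′ → a % 2 ≡ a′ % 2 → b % 2 ≡ b′ % 2 →
              (a + b) % 2 ≡ (a′ + b′) % 2
+-cong-mod2 a a′ b b′ a≡a′ b≡b′ = begin
  (a + b) % 2               ≡⟨ %-distribˡ-+ a b 2 ⟩
  (a % 2 + b % 2) % 2       ≡⟨ cong₂ (λ x y → (x + y) % 2) a≡a′ b≡b′ ⟩
  (a′ % 2 + b′ % 2) % 2     ≡⟨ %-distribˡ-+ a′ b′ 2 ⟨
  (a′ + b′) % 2             ∎

suc-cong-mod2 : ∀ b b′ → b % 2 ≡ b′ % 2 → suc b % 2 ≡ suc b′ % 2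
suc-cong-mod2 b b′ = +-cong-mod2 1 1 b b′ refl

sum-odd-mod2 : ∀ {A : Set} (f : A → ℕ) (xs : List A) → All (λ x → Odd (f x)) xs →
               sumList (List.map f xs) % 2 ≡ length xs % 2
sum-odd-mod2 f List.[]       All.[]         = refl
sum-odd-mod2 f (x List.∷ xs) (odd All.∷ os) =
  +-cong-mod2 (f x) 1 (sumList (List.map f xs)) (length xs) odd (sum-odd-mod2 f xs os)

+-multiple-mod : ∀ b q r → (b + q * r) ≡ b [mod r ]
+-multiple-mod b q r = subst (λ d → r ℕ∣.∣ d) (sym ∣difference∣) (ℕ∣.n∣m*n q)
  where
  ∣difference∣ : ℤ.∣ ℤ.+ (b + q * r) ℤ.- ℤ.+ b ∣ ≡ q * r
  ∣difference∣ = begin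
    ℤ.∣ ℤ.+ (b + q * r) ℤ.- ℤ.+ b ∣   ≡⟨ cong ℤ.∣_∣ ([+m]-[+n]≡m⊖n (b + q * r) b) ⟩
    ℤ.∣ (b + q * r) ℤ.⊖ b ∣           ≡⟨ cong ℤ.∣_∣ (⊖-≥ (m≤m+n b (q * r))) ⟩
    b + q * r ∸ b                      ≡⟨ m+n∸m≡n b (q * r) ⟩
    q * r                              ∎

_⊕_ : ∀ {n} → Subset n → Subset n → Subset n
_⊕_ = zipWith _xor_

-- The 𝔽₂-sum of a family of edges; it is ∅ exactly when every vertex has even degree.
edgeSum : ∀ {n} → List (Subset n) → Subset n
edgeSum = foldr _⊕_ ⊥

∣∩⊥∣≡0 : ∀ {n} (X : Subset n) → ∣ X ∩ ⊥ ∣ ≡ 0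
∣∩⊥∣≡0 {n} X = trans (cong ∣_∣ (∩-zeroʳ X)) (∣⊥∣≡0 n)

∣∩⊕∣-mod2 : ∀ {n} (X e f : Subset n) →
            ∣ X ∩ (e ⊕ f) ∣ % 2 ≡ (∣ X ∩ e ∣ + ∣ X ∩ f ∣) % 2
∣∩⊕∣-mod2 []            []            []            = refl
∣∩⊕∣-mod2 (outside ∷ X) (_ ∷ e)       (_ ∷ f)       = ∣∩⊕∣-mod2 X e f
∣∩⊕∣-mod2 (inside ∷ X)  (outside ∷ e) (outside ∷ f) = ∣∩⊕∣-mod2 X e f
∣∩⊕∣-mod2 (inside ∷ X)  (inside ∷ e)  (outside ∷ f) =
  suc-cong-mod2 (∣ X ∩ (e ⊕ f) ∣) (∣ X ∩ e ∣ + ∣ X ∩ f ∣) (∣∩⊕∣-mod2 X e f)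
∣∩⊕∣-mod2 (inside ∷ X)  (outside ∷ e) (inside ∷ f)  =
  trans (suc-cong-mod2 (∣ X ∩ (e ⊕ f) ∣) (∣ X ∩ e ∣ + ∣ X ∩ f ∣) (∣∩⊕∣-mod2 X e f))
        (cong (_% 2) (sym (+-suc ∣ X ∩ e ∣ ∣ X ∩ f ∣)))
∣∩⊕∣-mod2 (inside ∷ X)  (inside ∷ e)  (inside ∷ f)  =
  trans (∣∩⊕∣-mod2 X e f)
        (cong (λ s → suc s % 2) (sym (+-suc ∣ X ∩ e ∣ ∣ X ∩ f ∣)))

∣∩edgeSum∣-mod2 : ∀ {n} (X : Subset n) (es : List (Subset n)) →
                  ∣ X ∩ edgeSum es ∣ % 2 ≡ sumList (List.map (λ e → ∣ X ∩ e ∣) es) % 2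
∣∩edgeSum∣-mod2 X List.[]       = cong (_% 2) (∣∩⊥∣≡0 X)
∣∩edgeSum∣-mod2 X (e List.∷ es) =
  trans (∣∩⊕∣-mod2 X e (edgeSum es))
        (+-cong-mod2 (∣ X ∩ e ∣) (∣ X ∩ e ∣) (∣ X ∩ edgeSum es ∣) (sumList (List.map (λ e → ∣ X ∩ e ∣) es))
                     refl (∣∩edgeSum∣-mod2 X es))

noOddTransversal : ∀ {r n} (G : Graph r n) →
                   edgeSum (edges G) ≡ ⊥ → Odd (length (edges G)) → ¬ HasOddTransversal G
noOddTransversal G evenDegrees oddEdges (X , transversal) = 1≢0 (begin
  1                                                    ≡⟨ oddEdges ⟨
  length (edges G) % 2                                 ≡⟨ sum-odd-mod2 (λ e → ∣ X ∩ e ∣) (edges G) transversal ⟨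
  sumList (List.map (λ e → ∣ X ∩ e ∣) (edges G)) % 2  ≡⟨ ∣∩edgeSum∣-mod2 X (edges G) ⟨
  ∣ X ∩ edgeSum (edges G) ∣ % 2                        ≡⟨ cong (λ s → ∣ X ∩ s ∣ % 2) evenDegrees ⟩
  ∣ X ∩ ⊥ ∣ % 2                                        ≡⟨ cong (_% 2) (∣∩⊥∣≡0 X) ⟩
  0                                                    ∎)
  where
  1≢0 : 1 ≢ 0
  1≢0 ()

∣∣-as-sumOver : ∀ {n} (s : Subset n) → ∣ s ∣ ≡ sumOver s (λ _ → 1)
∣∣-as-sumOver []            = refl
∣∣-as-sumOver (outside ∷ s) = ∣∣-as-sumOver s
∣∣-as-sumOver (inside ∷ s)  = cong suc (∣∣-as-sumOver s)

-- Vertex sets described by a vector L of labels: vertex i has label lookup L i,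
-- and an edge is the set of vertices whose label satisfies a predicate.
module Labelled {Label : Set} where

  restrict : (Label → Bool) → (Label → ℕ) → Label → ℕ
  restrict P g l = if P l then g l else 0

  sumOver-labelled : ∀ {n} (P : Label → Bool) (g : Label → ℕ) (L : Vec Label n) →
                     sumOver (map P L) (λ i → g (lookup L i)) ≡ sum (map (restrict P g) L)
  sumOver-labelled P g []      = refl
  sumOver-labelled P g (l ∷ L) with P l
  ... | true  = cong (g l +_) (sumOver-labelled P g L)
  ... | false = sumOver-labelled P g L

  sum-map-++ : ∀ {m n} (g : Label → ℕ) (xs : Vec Label m) (ys : Vec Label n) →
               sum (map g (xs ++ ys)) ≡ sum (map g xs) + sum (map g ys)
  sum-map-++ g xs ys = trans (cong sum (map-++ g xs ys)) (sum-++ (map g xs))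

  sum-map-replicate : ∀ (g : Label → ℕ) n (l : Label) → sum (map g (replicate n l)) ≡ n * g l
  sum-map-replicate g zero    l = refl
  sum-map-replicate g (suc n) l = cong (g l +_) (sum-map-replicate g n l)

  ∈-replicate : ∀ n .{{_ : NonZero n}} (l : Label) → l ∈ replicate n l
  ∈-replicate (suc n) l = here refl

  map-≡-∈ : ∀ {n} {P Q : Label → Bool} {L : Vec Label n} {l} →
            map P L ≡ map Q L → l ∈ L → P l ≡ Q l
  map-≡-∈ {L = _ ∷ _} eq (here refl) = proj₁ (∷-injective eq)
  map-≡-∈ {L = _ ∷ _} eq (there l∈L) = map-≡-∈ (proj₂ (∷-injective eq)) l∈L

  -- Pointwise xor of a family of predicates: the parity of the degree of a label.
  xorAll : ∀ {I : Set} → (I → Label → Bool) → List I → Label → Bool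
  xorAll pred Zs l = foldr (λ Z acc → pred Z l xor acc) false Zs

  ⊕-map : ∀ {n} (P Q : Label → Bool) (L : Vec Label n) →
          map P L ⊕ map Q L ≡ map (λ l → P l xor Q l) L
  ⊕-map P Q []      = refl
  ⊕-map P Q (l ∷ L) = cong ((P l xor Q l) ∷_) (⊕-map P Q L)

  edgeSum-labelled : ∀ {I : Set} {n} (pred : I → Label → Bool) (Zs : List I) (L : Vec Label n) →
                     edgeSum (List.map (λ Z → map (pred Z) L) Zs) ≡ map (xorAll pred Zs) L
  edgeSum-labelled pred List.[]       L = sym (map-const L false)
  edgeSum-labelled pred (Z List.∷ Zs) L = begin
    map (pred Z) L ⊕ edgeSum (List.map (λ Z → map (pred Z) L) Zs)
      ≡⟨ cong (map (pred Z) L ⊕_) (edgeSum-labelled pred Zs L) ⟩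
    map (pred Z) L ⊕ map (xorAll pred Zs) L
      ≡⟨ ⊕-map (pred Z) (xorAll pred Zs) L ⟩
    map (xorAll pred (Z List.∷ Zs)) L
      ∎

open Labelled

data Corner : Set where
  a b c : Corner

corners : List Corner
corners = a List.∷ b List.∷ c List.∷ List.[]

data Block : Set where
  corner   : Corner → Block
  isolated : Block

inOpposite : Corner → Block → Bool
inOpposite _ isolated   = false
inOpposite a (corner a) = false
inOpposite b (corner b) = false
inOpposite c (corner c) = false
inOpposite _ (corner _) = true

inOpposite-self : ∀ Z → inOpposite Z (corner Z) ≡ false
inOpposite-self a = refl
inOpposite-self b = refl
inOpposite-self c = refl

inOpposite-other : ∀ {Z X} → X ≢ Z → inOpposite Z (corner X) ≡ true
inOpposite-other {a} {a} X≢Z = contradiction refl X≢Z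
inOpposite-other {b} {b} X≢Z = contradiction refl X≢Z
inOpposite-other {c} {c} X≢Z = contradiction refl X≢Z
inOpposite-other {a} {b} _   = refl
inOpposite-other {a} {c} _   = refl
inOpposite-other {b} {a} _   = refl
inOpposite-other {b} {c} _   = refl
inOpposite-other {c} {a} _   = refl
inOpposite-other {c} {b} _   = refl

-- Every vertex lies in zero or two of the three edges, so its degree is even.
evenDegree : ∀ X → xorAll (λ Z → inOpposite Z) corners X ≡ false
evenDegree (corner a) = refl
evenDegree (corner b) = refl
evenDegree (corner c) = refl
evenDegree isolated   = refl

two-of-three : ∀ (Z : Corner) (w t : ℕ) →
  (if inOpposite Z (corner a) then w else 0) +
  ((if inOpposite Z (corner b) then w else 0) + ((if inOpposite Z (corner c) then w else 0) + t))
  ≡ w + (w + t)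
two-of-three a w t = refl
two-of-three b w t = refl
two-of-three c w t = refl

module TriangleBlowUp (k : ℕ) .{{_ : NonZero k}} (m : ℕ) where

  r : ℕ
  r = 4 * k

  -- Since k ≠ 0 there is room for the colours 1 and 2.
  2≤r : 2 ≤ r
  2≤r = ≤-trans (s≤s (s≤s z≤n)) (m≤m*n 4 k)

  -- Colours 1 and 2, encoded as Fin r by subtracting one.
  colour₁ colour₂ : Fin r
  colour₁ = fromℕ< (≤-trans (s≤s z≤n) 2≤r)
  colour₂ = fromℕ< 2≤r

  Label : Set
  Label = Block × Fin r

  colourValue : Label → ℕ
  colourValue l = suc (toℕ (proj₂ l))

  block : Corner → Vec Label (k + k)
  block X = replicate k (corner X , colour₂) ++ replicate k (corner X , colour₁)

  order : ℕ
  order = k + k + (k + k + (k + k + m))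

  layout : Vec Label order
  layout = block a ++ (block b ++ (block c ++ replicate m (isolated , colour₁)))

  edge : Corner → Subset order
  edge Z = map (inOpposite Z ∘ proj₁) layout

  colouring : Fin order → Fin r
  colouring i = proj₂ (lookup layout i)

  blockWeight : (Label → ℕ) → Corner → ℕ
  blockWeight g X = k * g (corner X , colour₂) + k * g (corner X , colour₁)

  sum-block : ∀ g X → sum (map g (block X)) ≡ blockWeight g X
  sum-block g X = trans (sum-map-++ g (replicate k _) (replicate k _))
    (cong₂ _+_ (sum-map-replicate g k _) (sum-map-replicate g k _))

  sum-layout : ∀ g → sum (map g layout) ≡
    blockWeight g a + (blockWeight g b + (blockWeight g c + m * g (isolated , colour₁)))
  sum-layout g = begin
    sum (map g layout)
      ≡⟨ sum-map-++ g (block a) _ ⟩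
    sum (map g (block a)) + sum (map g (block b ++ (block c ++ isolatedPart)))
      ≡⟨ cong₂ _+_ (sum-block g a) (sum-map-++ g (block b) _) ⟩
    blockWeight g a + (sum (map g (block b)) + sum (map g (block c ++ isolatedPart)))
      ≡⟨ cong (blockWeight g a +_) (cong₂ _+_ (sum-block g b) (sum-map-++ g (block c) _)) ⟩
    blockWeight g a + (blockWeight g b + (sum (map g (block c)) + sum (map g isolatedPart)))
      ≡⟨ cong (λ s → blockWeight g a + (blockWeight g b + s))
              (cong₂ _+_ (sum-block g c) (sum-map-replicate g m _)) ⟩
    blockWeight g a + (blockWeight g b + (blockWeight g c + m * g (isolated , colour₁)))
      ∎
    where
    isolatedPart : Vec Label m
    isolatedPart = replicate m (isolated , colour₁)

  sum-edge : ∀ Z (g : Label → ℕ) (w : ℕ) → (∀ X → blockWeight g X ≡ w) →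
             sumOver (edge Z) (λ i → g (lookup layout i)) ≡ w + w
  sum-edge Z g w uniform = begin
    sumOver (edge Z) (λ i → g (lookup layout i))
      ≡⟨ sumOver-labelled (inOpposite Z ∘ proj₁) g layout ⟩
    sum (map g′ layout)
      ≡⟨ sum-layout g′ ⟩
    blockWeight g′ a + (blockWeight g′ b + (blockWeight g′ c + m * 0))
      ≡⟨ cong₂ _+_ (restricted a) (cong₂ _+_ (restricted b) (cong₂ _+_ (restricted c) (*-zeroʳ m))) ⟩
    ifIn a + (ifIn b + (ifIn c + 0))
      ≡⟨ two-of-three Z w 0 ⟩
    w + (w + 0)
      ≡⟨ cong (w +_) (+-identityʳ w) ⟩
    w + w
      ∎
    where
    g′ : Label → ℕ
    g′ = restrict (inOpposite Z ∘ proj₁) g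
    ifIn : Corner → ℕ
    ifIn X = if inOpposite Z (corner X) then w else 0
    restricted : ∀ X → blockWeight g′ X ≡ ifIn X
    restricted X with inOpposite Z (corner X)
    ... | true  = uniform X
    ... | false = cong₂ _+_ (*-zeroʳ k) (*-zeroʳ k)

  edge-size : ∀ Z → ∣ edge Z ∣ ≡ r
  edge-size Z = begin
    ∣ edge Z ∣                         ≡⟨ ∣∣-as-sumOver (edge Z) ⟩
    sumOver (edge Z) (λ _ → 1)         ≡⟨ sum-edge Z (λ _ → 1) (k * 1 + k * 1) (λ _ → refl) ⟩
    (k * 1 + k * 1) + (k * 1 + k * 1)  ≡⟨ fourBlocks k ⟩
    4 * k                              ∎
    where
    fourBlocks : ∀ k → (k * 1 + k * 1) + (k * 1 + k * 1) ≡ 4 * k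
    fourBlocks = solve-∀

  blockColourSum : ∀ X → blockWeight colourValue X ≡ k * 2 + k * 1
  blockColourSum X = cong₂ (λ x y → k * suc x + k * suc y) (toℕ-fromℕ< _) (toℕ-fromℕ< _)

  -- Every edge has colour sum 6k = 2k + 4k ≡ r/2 (mod r).
  edge-colourSum : ∀ Z → sumOver (edge Z) (λ i → suc (toℕ (colouring i))) ≡ r / 2 [mod r ]
  edge-colourSum Z =
    subst₂ (λ x y → x ≡ y [mod r ]) (sym colourSum) (sym half) (+-multiple-mod (2 * k) 1 r)
    where
    colourSum : sumOver (edge Z) (λ i → suc (toℕ (colouring i))) ≡ 2 * k + 1 * r
    colourSum = trans (sum-edge Z colourValue _ blockColourSum) (sixK k)
      where
      sixK : ∀ k → (k * 2 + k * 1) + (k * 2 + k * 1) ≡ 2 * k + 1 * (4 * k)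
      sixK = solve-∀
    half : r / 2 ≡ 2 * k
    half = trans (cong (_/ 2) (double k)) (m*n/n≡m (2 * k) 2)
      where
      double : ∀ k → 4 * k ≡ 2 * k * 2
      double = solve-∀

  -- Each block really occurs in the layout (blocks are nonempty since k ≠ 0).
  block-vertex : ∀ Y → (corner Y , colour₂) ∈ layout
  block-vertex a = ∈-++⁺ˡ (∈-++⁺ˡ (∈-replicate k _))
  block-vertex b = ∈-++⁺ʳ (block a) (∈-++⁺ˡ (∈-++⁺ˡ (∈-replicate k _)))
  block-vertex c = ∈-++⁺ʳ (block a) (∈-++⁺ʳ (block b) (∈-++⁺ˡ (∈-++⁺ˡ (∈-replicate k _))))

  -- Distinct corners give distinct edges: a vertex of block X lies in the edge
  -- opposite Z but not in the edge opposite X.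
  edge-injective : ∀ {X Z} → X ≢ Z → edge X ≢ edge Z
  edge-injective {X} {Z} X≢Z eq = contradiction disagree (λ ())
    where
    disagree : false ≡ true
    disagree = begin
      false                    ≡⟨ inOpposite-self X ⟨
      inOpposite X (corner X)  ≡⟨ map-≡-∈ eq (block-vertex X) ⟩
      inOpposite Z (corner X)  ≡⟨ inOpposite-other X≢Z ⟩
      true                     ∎

  forEachEdge : ∀ {P : Subset order → Set} → (∀ Z → P (edge Z)) → All P (List.map edge corners)
  forEachEdge p = p a All.∷ p b All.∷ p c All.∷ All.[]

  graph : Graph r order
  graph = record
    { edges    = List.map edge corners
    ; distinct = (edge-injective (λ ()) All.∷ edge-injective (λ ()) All.∷ All.[])
                 AllPairs.∷ (edge-injective (λ ()) All.∷ All.[])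
                 AllPairs.∷ All.[] AllPairs.∷ AllPairs.[]
    ; uniform  = forEachEdge edge-size
    }

  colourable : OddColorable graph
  colourable = colouring , forEachEdge edge-colourSum

  evenDegrees : edgeSum (edges graph) ≡ ⊥
  evenDegrees = begin
    edgeSum (List.map edge corners)
      ≡⟨ edgeSum-labelled (λ Z → inOpposite Z ∘ proj₁) corners layout ⟩
    map (xorAll (λ Z → inOpposite Z ∘ proj₁) corners) layout
      ≡⟨ map-cong (evenDegree ∘ proj₁) layout ⟩
    map (λ _ → false) layout
      ≡⟨ map-const layout false ⟩
    ⊥
      ∎

  noTransversal : ¬ HasOddTransversal graph
  noTransversal = noOddTransversal graph evenDegrees refl

-- Since n ≥ 8k ≥ 6k, the blown-up triangle with n - 6k isolated vertices has order n.
proposition6 : (k n : ℕ) → .{{_ : NonZero k}} → 8 * k ≤ n →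
    Σ (Graph (4 * k) n) λ G → OddColorable G × ¬ HasOddTransversal G
proposition6 k n 8k≤n = subst Answer order≡n (graph , colourable , noTransversal)
  where
  Answer : ℕ → Set
  Answer n = Σ (Graph (4 * k) n) λ G → OddColorable G × ¬ HasOddTransversal G
  6k≤n : 6 * k ≤ n
  6k≤n = ≤-trans (*-monoˡ-≤ k (m≤m+n 6 2)) 8k≤n
  m : ℕ
  m = proj₁ (m≤n⇒∃[o]m+o≡n 6k≤n)
  open TriangleBlowUp k m
  order≡n : order ≡ n
  order≡n = trans (sixBlocks k m) (proj₂ (m≤n⇒∃[o]m+o≡n 6k≤n))
    where
    sixBlocks : ∀ k m → k + k + (k + k + (k + k + m)) ≡ 6 * k + m
    sixBlocks = solve-∀
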